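{- Let $(B,+,0)$ be a fixed-point-free K-loop containing an element of infinite order. Then $B$ contains an infinite definable subloop which is an abelian group.
   Context: A K-loop is a structure $(B,+,0)$ with $0+a=a+0=a$, where for all $a,b$ the equations $x+a=b$ and $a+y=b$ have unique solutions, satisfying the Bol condition $a+(b+(a+c))=(a+(b+a))+c$ and the automorphic inverse property $-(a+b)=-a-b$. Each element $x$ generates a cyclic group $\{x\cdot n:n\in\mathbb{Z}\}$; $x$ has infinite order if this group is infinite. The precession maps $\delta_{a,b}$ are defined by $a+(b+c)=(a+b)+\delta_{a,b}(c)$; $D(B)$ is the group they generate. $B$ is fixed-point-free if every nontrivial element of $D(B)$ fixes no nonzero element. Definable means definable with parameters in $(B,+,0)$. -}

module Defs where

open import Data.Nat using (ℕ; zero; suc)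
open import Data.Integer using (ℤ; +_; -[1+_])
open import Data.Fin using (Fin)
open import Data.Vec using (Vec; _∷_; lookup)
open import Data.List using (List; _∷_; [])
open import Data.List.Membership.Propositional using (_∈_)
open import Data.Bool using (Bool; true; false)
open import Data.Product using (Σ; _×_; _,_; proj₁; ∃)
open import Data.Sum using (_⊎_)
open import Data.Empty using (⊥)
open import Relation.Nullary using (¬_)
open import Relation.Binary.PropositionalEquality using (_≡_)

record KLoop : Set₁ where
  infixl 6 _+_
  field
    Carrier : Set
    _+_     : Carrier → Carrier → Carrier
    0#      : Carrier
    identityˡ : ∀ a → 0# + a ≡ a
    identityʳ : ∀ a → a + 0# ≡ a
    rsol     : ∀ a b → Σ Carrier λ x → (x + a ≡ b) × (∀ x' → x' + a ≡ b → x' ≡ x)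
    lsol     : ∀ a b → Σ Carrier λ y → (a + y ≡ b) × (∀ y' → a + y' ≡ b → y' ≡ y)

  _＼_ : Carrier → Carrier → Carrier
  a ＼ b = proj₁ (lsol a b)

  _／_ : Carrier → Carrier → Carrier
  b ／ a = proj₁ (rsol a b)

  -_ : Carrier → Carrier
  - a = a ＼ 0#

  field
    bol   : ∀ a b c → a + (b + (a + c)) ≡ (a + (b + a)) + c
    autInv : ∀ a b → - (a + b) ≡ (- a) + (- b)

module _ (L : KLoop) where
  open KLoop L renaming (Carrier to B)

  δ : B → B → B → B
  δ a b c = (a + b) ＼ (a + (b + c))

  δ⁻¹ : B → B → B → B
  δ⁻¹ a b c = b ＼ (a ＼ ((a + b) + c))

  -- Elements of D(B) = group generated by the δ_{a,b}: words in the
  -- generators and their inverses (true = generator, false = inverse).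
  DWord : Set
  DWord = List (B × B × Bool)

  evalD : DWord → B → B
  evalD [] c = c
  evalD ((a , b , true) ∷ w) c = δ a b (evalD w c)
  evalD ((a , b , false) ∷ w) c = δ⁻¹ a b (evalD w c)

  FixedPointFree : Set
  FixedPointFree = ∀ (w : DWord) → ¬ (∀ c → evalD w c ≡ c) →
                   ∀ x → evalD w x ≡ x → x ≡ 0#

  Subset : Set₁
  Subset = B → Set

  Finite : Subset → Set
  Finite S = Σ (List B) λ xs → ∀ x → S x → x ∈ xs

  Infinite : Subset → Set
  Infinite S = ¬ Finite S

  mulℕ : B → ℕ → B
  mulℕ x zero = 0#
  mulℕ x (suc n) = x + mulℕ x n

  _·_ : B → ℤ → B
  x · (+ n) = mulℕ x n
  x · -[1+ n ] = - (mulℕ x (suc n))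

  cyclic : B → Subset
  cyclic x y = ∃ λ (n : ℤ) → x · n ≡ y

  InfiniteOrder : B → Set
  InfiniteOrder x = Infinite (cyclic x)

  record IsSubloop (S : Subset) : Set where
    field
      has-0 : S 0#
      +-closed : ∀ {a b} → S a → S b → S (a + b)
      ＼-closed : ∀ {a b} → S a → S b → S (a ＼ b)
      ／-closed : ∀ {a b} → S a → S b → S (b ／ a)

  IsAbelianGroupOn : Subset → Set
  IsAbelianGroupOn S =
    (∀ {a b c} → S a → S b → S c → (a + b) + c ≡ a + (b + c)) ×
    (∀ {a b} → S a → S b → a + b ≡ b + a)

  -- First-order formulas in the language (+, 0) with parameters from B
  -- (parameters appear as constants), variables de Bruijn (Fin n).

  data Term (n : ℕ) : Set where
    var  : Fin n → Term n
    par  : B → Term n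
    zer  : Term n
    plus : Term n → Term n → Term n

  data Formula : ℕ → Set where
    eq   : ∀ {n} → Term n → Term n → Formula n
    fals : ∀ {n} → Formula n
    neg  : ∀ {n} → Formula n → Formula n
    and  : ∀ {n} → Formula n → Formula n → Formula n
    or   : ∀ {n} → Formula n → Formula n → Formula n
    imp  : ∀ {n} → Formula n → Formula n → Formula n
    all  : ∀ {n} → Formula (suc n) → Formula n
    ex   : ∀ {n} → Formula (suc n) → Formula n

  evalT : ∀ {n} → Term n → Vec B n → B
  evalT (var i) ρ = lookup ρ i
  evalT (par p) ρ = p
  evalT zer ρ = 0#
  evalT (plus s t) ρ = evalT s ρ + evalT t ρ

  Sat : ∀ {n} → Formula n → Vec B n → Set
  Sat (eq s t) ρ = evalT s ρ ≡ evalT t ρ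
  Sat fals ρ = ⊥
  Sat (neg φ) ρ = ¬ Sat φ ρ
  Sat (and φ ψ) ρ = Sat φ ρ × Sat ψ ρ
  Sat (or φ ψ) ρ = Sat φ ρ ⊎ Sat ψ ρ
  Sat (imp φ ψ) ρ = Sat φ ρ → Sat ψ ρ
  Sat (all φ) ρ = ∀ x → Sat φ (x ∷ ρ)
  Sat (ex φ) ρ = Σ B λ x → Sat φ (x ∷ ρ)

  Definable : Subset → Set
  Definable S = Σ (Formula 1) λ φ →
    ∀ x → (S x → Sat φ (x ∷ Data.Vec.[])) × (Sat φ (x ∷ Data.Vec.[]) → S x)

{-# OPTIONS --safe #-}
-- Write a ⇄ t when a + (t + c) = (a + t) + c = t + (a + c) for every c.  The
-- Bol identity with b = 0 makes ⇄ reflexive, and its instance c = 0 makes it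
-- symmetric.  The bicommutant {y | ∀ t → x ⇄ t → y ⇄ t} is first-order
-- definable with parameter x and contains x.  The Bol identity, the left
-- inverse property and the automorphic inverse property make it closed under
-- +, - and both divisions.  Any two of its elements satisfy ⇄, so it is an
-- abelian group, and it is infinite because it contains the cyclic group of x.
module Submission where

open import Defs
open import Data.Product using (Σ; _×_; _,_; proj₁; proj₂)
open import Data.Nat using (zero; suc)
import Data.Integer as ℤ
import Data.Fin as Fin
open import Relation.Unary using (_⊆_)
open import Relation.Binary.PropositionalEquality
open ≡-Reasoning

module KLoopProperties (L : KLoop) where
  open KLoop L renaming (Carrier to B)

  +-cancelˡ : ∀ a {y y'} → a + y ≡ a + y' → y ≡ y'
  +-cancelˡ a {y} {y'} e = trans (unique y e) (sym (unique y' refl))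
    where unique = proj₂ (proj₂ (lsol a (a + y')))

  +-inverseʳ : ∀ a → a + - a ≡ 0#
  +-inverseʳ a = proj₁ (proj₂ (lsol a 0#))

  bol-square : ∀ a c → a + (a + c) ≡ (a + a) + c
  bol-square a c = begin
    a + (a + c)         ≡⟨ cong (a +_) (sym (identityˡ (a + c))) ⟩
    a + (0# + (a + c))  ≡⟨ bol a 0# c ⟩
    (a + (0# + a)) + c  ≡⟨ cong (λ z → (a + z) + c) (identityˡ a) ⟩
    (a + a) + c         ∎

  -- The left inverse property is first proved for the right inverse 0 ／ a,
  -- which then turns out to be - a.
  private
    +-inverseˡ-／ : ∀ a → (0# ／ a) + a ≡ 0#
    +-inverseˡ-／ a = proj₁ (proj₂ (rsol a 0#))

    left-inverse-property-／ : ∀ a c → (0# ／ a) + (a + c) ≡ c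
    left-inverse-property-／ a c = +-cancelˡ a (begin
      a + ((0# ／ a) + (a + c))  ≡⟨ bol a (0# ／ a) c ⟩
      (a + ((0# ／ a) + a)) + c  ≡⟨ cong (λ z → (a + z) + c) (+-inverseˡ-／ a) ⟩
      (a + 0#) + c               ≡⟨ cong (_+ c) (identityʳ a) ⟩
      a + c                      ∎)

    ／-inverse≡- : ∀ a → 0# ／ a ≡ - a
    ／-inverse≡- a = begin
      0# ／ a                  ≡⟨ sym (identityʳ (0# ／ a)) ⟩
      (0# ／ a) + 0#           ≡⟨ cong ((0# ／ a) +_) (sym (+-inverseʳ a)) ⟩
      (0# ／ a) + (a + - a)    ≡⟨ left-inverse-property-／ a (- a) ⟩
      - a                      ∎

  left-inverse-property : ∀ a c → - a + (a + c) ≡ c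
  left-inverse-property a c =
    subst (λ z → z + (a + c) ≡ c) (／-inverse≡- a) (left-inverse-property-／ a c)

  +-inverseˡ : ∀ a → - a + a ≡ 0#
  +-inverseˡ a = subst (λ z → z + a ≡ 0#) (／-inverse≡- a) (+-inverseˡ-／ a)

  -‿involutive : ∀ a → - - a ≡ a
  -‿involutive a = sym (proj₂ (proj₂ (lsol (- a) 0#)) a (+-inverseˡ a))

  left-inverse-property′ : ∀ a c → a + (- a + c) ≡ c
  left-inverse-property′ a c =
    subst (λ z → z + (- a + c) ≡ c) (-‿involutive a) (left-inverse-property (- a) c)

  ＼≡-+ : ∀ a b → a ＼ b ≡ - a + b
  ＼≡-+ a b = sym (proj₂ (proj₂ (lsol a b)) (- a + b) (left-inverse-property′ a b))

  -‿distrib-+ʳ : ∀ a b c → - (a + (b + c)) ≡ - a + (- b + - c)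
  -‿distrib-+ʳ a b c = trans (autInv a (b + c)) (cong (- a +_) (autInv b c))

  -‿distrib-+ˡ : ∀ a b c → - ((a + b) + c) ≡ (- a + - b) + - c
  -‿distrib-+ˡ a b c = trans (autInv (a + b) c) (cong (_+ - c) (autInv a b))

  Coherent : B → B → B → Set
  Coherent a t c = (a + (t + c) ≡ (a + t) + c) × (a + (t + c) ≡ t + (a + c))

  infix 4 _⇄_
  _⇄_ : B → B → Set
  a ⇄ t = ∀ c → Coherent a t c

  ⇄-assoc : ∀ {a t} → a ⇄ t → ∀ c → a + (t + c) ≡ (a + t) + c
  ⇄-assoc h c = proj₁ (h c)

  ⇄-swap : ∀ {a t} → a ⇄ t → ∀ c → a + (t + c) ≡ t + (a + c)
  ⇄-swap h c = proj₂ (h c)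

  swap⇒comm : ∀ {a t} → (∀ c → a + (t + c) ≡ t + (a + c)) → a + t ≡ t + a
  swap⇒comm {a} {t} swap = begin
    a + t         ≡⟨ cong (a +_) (sym (identityʳ t)) ⟩
    a + (t + 0#)  ≡⟨ swap 0# ⟩
    t + (a + 0#)  ≡⟨ cong (t +_) (identityʳ a) ⟩
    t + a         ∎

  ⇄-comm : ∀ {a t} → a ⇄ t → a + t ≡ t + a
  ⇄-comm h = swap⇒comm (⇄-swap h)

  ⇄-refl : ∀ a → a ⇄ a
  ⇄-refl a c = bol-square a c , refl

  ⇄-sym : ∀ {a t} → a ⇄ t → t ⇄ a
  ⇄-sym {a} {t} h c = assoc , sym (⇄-swap h c)
    where
    assoc : t + (a + c) ≡ (t + a) + c
    assoc = begin
      t + (a + c)  ≡⟨ sym (⇄-swap h c) ⟩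
      a + (t + c)  ≡⟨ ⇄-assoc h c ⟩
      (a + t) + c  ≡⟨ cong (_+ c) (⇄-comm h) ⟩
      (t + a) + c  ∎

  0⇄ : ∀ t → 0# ⇄ t
  0⇄ t c = trans (identityˡ (t + c)) (cong (_+ c) (sym (identityˡ t))) ,
           trans (identityˡ (t + c)) (cong (t +_) (sym (identityˡ c)))

  ⇄-+ˡ-self : ∀ {a t} → a ⇄ t → a ⇄ a + t
  ⇄-+ˡ-self {a} {t} h c = assoc , swap
    where
    expand : a + ((a + t) + c) ≡ a + (t + (a + c))
    expand = cong (a +_) (trans (sym (⇄-assoc h c)) (⇄-swap h c))
    assoc : a + ((a + t) + c) ≡ (a + (a + t)) + c
    assoc = begin
      a + ((a + t) + c)   ≡⟨ expand ⟩
      a + (t + (a + c))   ≡⟨ bol a t c ⟩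
      (a + (t + a)) + c   ≡⟨ cong (λ z → (a + z) + c) (sym (⇄-comm h)) ⟩
      (a + (a + t)) + c   ∎
    swap : a + ((a + t) + c) ≡ (a + t) + (a + c)
    swap = trans expand (⇄-assoc h (a + c))

  ⇄-negʳ : ∀ {a t} → a ⇄ t → a ⇄ - t
  ⇄-negʳ {a} {t} h c = assoc , swap c
    where
    swap : ∀ c → a + (- t + c) ≡ - t + (a + c)
    swap c = begin
      a + (- t + c)              ≡⟨ sym (left-inverse-property t _) ⟩
      - t + (t + (a + (- t + c)))  ≡⟨ cong (- t +_) (sym (⇄-swap h (- t + c))) ⟩
      - t + (a + (t + (- t + c)))  ≡⟨ cong (λ z → - t + (a + z)) (left-inverse-property′ t c) ⟩
      - t + (a + c)              ∎
    a+t-t≡a : (a + t) + - t ≡ a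
    a+t-t≡a = begin
      (a + t) + - t  ≡⟨ sym (⇄-assoc h (- t)) ⟩
      a + (t + - t)  ≡⟨ cong (a +_) (+-inverseʳ t) ⟩
      a + 0#         ≡⟨ identityʳ a ⟩
      a              ∎
    assoc : a + (- t + c) ≡ (a + - t) + c
    assoc = begin
      a + (- t + c)                ≡⟨ sym (left-inverse-property t _) ⟩
      - t + (t + (a + (- t + c)))  ≡⟨ cong (- t +_) (sym (⇄-swap h (- t + c))) ⟩
      - t + (a + (t + (- t + c)))  ≡⟨ cong (- t +_) (⇄-assoc h (- t + c)) ⟩
      - t + ((a + t) + (- t + c))  ≡⟨ bol (- t) (a + t) c ⟩
      (- t + ((a + t) + - t)) + c  ≡⟨ cong (λ z → (- t + z) + c) a+t-t≡a ⟩
      (- t + a) + c                ≡⟨ cong (_+ c) (sym (swap⇒comm swap)) ⟩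
      (a + - t) + c                ∎

  ⇄-neg : ∀ {a t} → a ⇄ t → - a ⇄ - t
  ⇄-neg {a} {t} h c = subst (Coherent (- a) (- t)) (-‿involutive c) (negated (- c))
    where
    negated : ∀ d → Coherent (- a) (- t) (- d)
    negated d =
      trans (sym (-‿distrib-+ʳ a t d))
            (trans (cong -_ (⇄-assoc h d)) (-‿distrib-+ˡ a t d)) ,
      trans (sym (-‿distrib-+ʳ a t d))
            (trans (cong -_ (⇄-swap h d)) (-‿distrib-+ʳ t a d))

  ⇄-+ˡ : ∀ {y z t} → y ⇄ z → y ⇄ t → z ⇄ t → y ⇄ z + t → y + z ⇄ t
  ⇄-+ˡ {y} {z} {t} yz yt zt y[zt] c = assoc , swap
    where
    assoc : (y + z) + (t + c) ≡ ((y + z) + t) + c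
    assoc = begin
      (y + z) + (t + c)  ≡⟨ sym (⇄-assoc yz (t + c)) ⟩
      y + (z + (t + c))  ≡⟨ cong (y +_) (⇄-assoc zt c) ⟩
      y + ((z + t) + c)  ≡⟨ ⇄-assoc y[zt] c ⟩
      (y + (z + t)) + c  ≡⟨ cong (_+ c) (⇄-assoc yz t) ⟩
      ((y + z) + t) + c  ∎
    swap : (y + z) + (t + c) ≡ t + ((y + z) + c)
    swap = begin
      (y + z) + (t + c)  ≡⟨ sym (⇄-assoc yz (t + c)) ⟩
      y + (z + (t + c))  ≡⟨ cong (y +_) (⇄-swap zt c) ⟩
      y + (t + (z + c))  ≡⟨ ⇄-swap yt (z + c) ⟩
      t + (y + (z + c))  ≡⟨ cong (t +_) (⇄-assoc yz c) ⟩
      t + ((y + z) + c)  ∎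

  ⇄-+ʳ : ∀ {x z t} → x ⇄ z → x ⇄ t → z ⇄ t → z ⇄ x + t → x ⇄ z + t
  ⇄-+ʳ {x} {z} {t} xz xt zt z[xt] c = assoc , swap
    where
    expand : x + ((z + t) + c) ≡ z + (x + (t + c))
    expand = trans (cong (x +_) (sym (⇄-assoc zt c))) (⇄-swap xz (t + c))
    assoc : x + ((z + t) + c) ≡ (x + (z + t)) + c
    assoc = begin
      x + ((z + t) + c)  ≡⟨ expand ⟩
      z + (x + (t + c))  ≡⟨ cong (z +_) (⇄-assoc xt c) ⟩
      z + ((x + t) + c)  ≡⟨ ⇄-assoc z[xt] c ⟩
      (z + (x + t)) + c  ≡⟨ cong (_+ c) (sym (⇄-swap xz t)) ⟩
      (x + (z + t)) + c  ∎
    swap : x + ((z + t) + c) ≡ (z + t) + (x + c)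
    swap = begin
      x + ((z + t) + c)  ≡⟨ expand ⟩
      z + (x + (t + c))  ≡⟨ cong (z +_) (⇄-swap xt c) ⟩
      z + (t + (x + c))  ≡⟨ ⇄-assoc zt (x + c) ⟩
      (z + t) + (x + c)  ∎

  ／≡+- : ∀ {a b} → b ⇄ - a → b ／ a ≡ b + - a
  ／≡+- {a} {b} h = sym (proj₂ (proj₂ (rsol a b)) (b + - a) (begin
    (b + - a) + a  ≡⟨ sym (⇄-assoc h a) ⟩
    b + (- a + a)  ≡⟨ cong (b +_) (+-inverseˡ a) ⟩
    b + 0#         ≡⟨ identityʳ b ⟩
    b              ∎))

  Infinite-mono : {S T : Subset L} → S ⊆ T → Infinite L S → Infinite L T
  Infinite-mono S⊆T infS (xs , covers) = infS (xs , λ y Sy → covers y (S⊆T Sy))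

  -- Negation is a subloop operation because - a = a ＼ 0#.
  cyclic⊆subloop : ∀ {S x} → IsSubloop L S → S x → cyclic L x ⊆ S
  cyclic⊆subloop {S} {x} sub Sx (n , refl) = multiple n
    where
    open IsSubloop sub
    natMultiple : ∀ m → S (mulℕ L x m)
    natMultiple zero    = has-0
    natMultiple (suc m) = +-closed Sx (natMultiple m)
    multiple : ∀ n → S (_·_ L x n)
    multiple (ℤ.+ m)    = natMultiple m
    multiple ℤ.-[1+ m ] = ＼-closed (natMultiple (suc m)) has-0

  Bicommutant : B → Subset L
  Bicommutant x y = ∀ t → x ⇄ t → y ⇄ t

  module _ {x : B} where

    Bicommutant⇒⇄ : ∀ {y} → Bicommutant x y → x ⇄ y
    Bicommutant⇒⇄ Sy = ⇄-sym (Sy x (⇄-refl x))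

    Bicommutant⇒⇄-pair : ∀ {y z} → Bicommutant x y → Bicommutant x z → y ⇄ z
    Bicommutant⇒⇄-pair Sy Sz = Sy _ (Bicommutant⇒⇄ Sz)

    Bicommutant-self : Bicommutant x x
    Bicommutant-self t xt = xt

    Bicommutant-0 : Bicommutant x 0#
    Bicommutant-0 t _ = 0⇄ t

    Bicommutant-+ : ∀ {y z} → Bicommutant x y → Bicommutant x z → Bicommutant x (y + z)
    Bicommutant-+ {y} {z} Sy Sz t xt =
      ⇄-+ˡ (Bicommutant⇒⇄-pair Sy Sz) (Sy t xt) (Sz t xt) (Sy (z + t) x⇄z+t)
      where
      x⇄z+t : x ⇄ z + t
      x⇄z+t = ⇄-+ʳ (Bicommutant⇒⇄ Sz) xt (Sz t xt) (Sz (x + t) (⇄-+ˡ-self xt))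

    Bicommutant-neg : ∀ {a} → Bicommutant x a → Bicommutant x (- a)
    Bicommutant-neg {a} Sa t xt =
      subst (- a ⇄_) (-‿involutive t) (⇄-neg (Sa (- t) (⇄-negʳ xt)))

    Bicommutant-isSubloop : IsSubloop L (Bicommutant x)
    Bicommutant-isSubloop = record
      { has-0    = Bicommutant-0
      ; +-closed = Bicommutant-+
      ; ＼-closed = λ {a} {b} Sa Sb →
          subst (Bicommutant x) (sym (＼≡-+ a b)) (Bicommutant-+ (Bicommutant-neg Sa) Sb)
      ; ／-closed = λ Sa Sb →
          subst (Bicommutant x) (sym (／≡+- (Bicommutant⇒⇄-pair Sb (Bicommutant-neg Sa))))
                (Bicommutant-+ Sb (Bicommutant-neg Sa))
      }

    Bicommutant-isAbelianGroup : IsAbelianGroupOn L (Bicommutant x)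
    Bicommutant-isAbelianGroup =
      (λ Sa Sb _ → sym (⇄-assoc (Bicommutant⇒⇄-pair Sa Sb) _)) ,
      (λ Sa Sb → ⇄-comm (Bicommutant⇒⇄-pair Sa Sb))

    Bicommutant-infinite : InfiniteOrder L x → Infinite L (Bicommutant x)
    Bicommutant-infinite =
      Infinite-mono (cyclic⊆subloop Bicommutant-isSubloop Bicommutant-self)

  CoherentFormula : ∀ {n} → Term L n → Term L n → Term L n → Formula L n
  CoherentFormula a t c =
    and (eq (plus a (plus t c)) (plus (plus a t) c))
        (eq (plus a (plus t c)) (plus t (plus a c)))

  Bicommutant-definable : ∀ x → Definable L (Bicommutant x)
  Bicommutant-definable x = formula , λ _ → (λ s → s) , (λ s → s)
    where
    y t c : Term L 3
    c = var Fin.zero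
    t = var (Fin.suc Fin.zero)
    y = var (Fin.suc (Fin.suc Fin.zero))
    formula : Formula L 1
    formula = all (imp (all (CoherentFormula (par x) t c)) (all (CoherentFormula y t c)))

mainTheorem4 : (L : KLoop) → FixedPointFree L →
    Σ (KLoop.Carrier L) (InfiniteOrder L) →
    Σ (Subset L) λ S →
    Infinite L S × Definable L S × IsSubloop L S × IsAbelianGroupOn L S
mainTheorem4 L _ (x , x-infinite) =
  Bicommutant x ,
  Bicommutant-infinite x-infinite ,
  Bicommutant-definable x ,
  Bicommutant-isSubloop ,
  Bicommutant-isAbelianGroup
  where open KLoopProperties L
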